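{- With the notation of the context, $F\big(T(X(1)) - c\big)$ is the constant sequence $(2,2,2,\dots)$.
   Context: For integers $m \geq 1$ and $0 \leq l \leq m$, $A_{l,m} = \frac{l!\, m!}{2^{m-l}} \sum_{k=l}^{m} 2^{k} \binom{2m-2k}{m-k}\binom{m+k}{m}\binom{k}{l}$; $\nu_2$ denotes the $2$-adic valuation. $X(1)$ is the sequence $(\nu_2(A_{1,m}))_{m \geq 1}$. Operators on sequences: $F(a_1,a_2,a_3,\dots) = (a_1,a_1,a_2,a_3,\dots)$ and $T(a_1,a_2,a_3,\dots) = (a_1,a_3,a_5,\dots)$. $c = (\nu_2(m))_{m \geq 1}$, and $T(X(1)) - c$ is the termwise difference. -}

module Defs where

open import Data.Nat using (ℕ; zero; suc; _+_; _*_; _∸_; _^_; _/_; _%_; _!)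
open import Data.Nat.Combinatorics using (_C_)
open import Data.List using (List; map; upTo)
open import Data.Nat.ListAction using (sum)
open import Data.Integer using (ℤ; +_; _-_)

-- 2-adic valuation of a natural number (with the convention ν₂ 0 = 0,
-- never used below on 0). Defined by recursion with fuel n, which suffices.
ν₂-fuel : ℕ → ℕ → ℕ
ν₂-fuel zero    n = 0
ν₂-fuel (suc f) zero = 0
ν₂-fuel (suc f) (suc n) with suc n % 2
... | zero  = suc (ν₂-fuel f (suc n / 2))
... | suc _ = 0

ν₂ : ℕ → ℕ
ν₂ n = ν₂-fuel n n

S : ℕ → ℕ → ℕ
S l m = sum (map term (upTo (suc (m ∸ l))))
  where
  term : ℕ → ℕ
  term j = let k = l + j in
    2 ^ k * (((2 * m ∸ 2 * k) C (m ∸ k)) * (((m + k) C m) * (k C l)))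

-- A_{l,m} = l! m! S(l,m) / 2^{m-l}  is a positive rational; its 2-adic
-- valuation is  ν₂(l! m! S(l,m)) - (m - l)  (an integer).
ν₂A : ℕ → ℕ → ℤ
ν₂A l m = + ν₂ ((l !) * ((m !) * S l m)) - + (m ∸ l)

-- Sequences (a₁, a₂, a₃, …) are represented 0-indexed: s i = a_{i+1}.
Seq : Set
Seq = ℕ → ℤ

X1 : Seq
X1 i = ν₂A 1 (suc i)

F : Seq → Seq
F a zero    = a zero
F a (suc i) = a i

T : Seq → Seq
T a i = a (2 * i)

c : Seq
c i = + ν₂ (suc i)

_⊖_ : Seq → Seq → Seq
(a ⊖ b) i = a i - b i

{-# OPTIONS --safe #-}
-- Write m! S(1,m) as Σ_{1≤k≤m} X_k with X_k = m! 2^k C(2j,j) C(m+k,m) k, j = m − k.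
-- Clearing the factorials, C(2j,j) j!² = (2j)! and C(m+k,m) m! k! = (m+k)!, gives
--   ν₂ X_k + ν₂(j!) + ν₂(k!) = m + ν₂ k + ν₂((m+k)!),
-- and superadditivity of n ↦ ν₂(n!) turns this into ν₂ X_k ≥ m + ν₂(m+1) + ν₂(k!), with
-- equality for k = 1 when m is odd. As ν₂(k!) ≥ 1 for k ≥ 2, for odd m the term X_1 alone
-- determines ν₂(m! S(1,m)) = m + ν₂(m+1), so ν₂(A_{1,m}) = 1 + ν₂(m+1); for m = 2i+1 this is
-- 2 + ν₂(i+1), two more than the i-th entry of c.
module Submission where

open import Defs
open import Data.Nat using (ℕ; zero; suc; _+_; _*_; _∸_; _^_; _≤_; _<_; s≤s; z≤n; _/_; _%_; _!; NonZero)
open import Data.Nat.Properties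
open import Data.Nat.DivMod using (m≡m%n+[m/n]*n; m%n<n; m/n<m; m/n*n≡m)
open import Data.Nat.Divisibility using (_∣_; divides; _∣0; ∣m⇒∣m*n; ∣m∣n⇒∣m+n)
open import Data.Nat.Combinatorics using (_C_; nC1≡n; nCk≡n!/k![n-k]!; k![n∸k]!∣n!)
open import Data.Nat.ListAction using (sum)
open import Data.Nat.Tactic.RingSolver using (solve-∀)
open import Data.Integer using (+_; _-_)
import Data.Integer.Properties as ℤ
open import Data.List using (List; []; _∷_; map; applyUpTo)
open import Data.List.Relation.Unary.All using (All; []; _∷_)
open import Data.List.Relation.Unary.All.Properties using (map⁺; applyUpTo⁺₁)
open import Data.Empty using (⊥-elim)
open import Function using (_∘_)
open import Relation.Binary.PropositionalEquality
open import Algebra.Properties.CommutativeSemigroup +-commutativeSemigroup using (x∙yz≈y∙xz)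

private
  variable
    a b x y : ℕ

infix 4 _≡2^_*odd

record _≡2^_*odd (x a : ℕ) : Set where
  constructor _,_
  field
    k          : ℕ
    factorised : x ≡ 2 ^ a * suc (2 * k)

odd-≡2^0*odd : ∀ k → suc (2 * k) ≡2^ 0 *odd
odd-≡2^0*odd k = k , sym (*-identityˡ (suc (2 * k)))

2*-≡2^*odd : x ≡2^ a *odd → 2 * x ≡2^ suc a *odd
2*-≡2^*odd {a = a} (k , refl) = k , sym (*-assoc 2 (2 ^ a) (suc (2 * k)))

≡2^ν₂-fuel*odd : ∀ f x → .{{NonZero x}} → x ≤ f → x ≡2^ ν₂-fuel f x *odd
≡2^ν₂-fuel*odd (suc f) (suc n) (s≤s n≤f)
  with suc n % 2 | m%n<n (suc n) 2 | m≡m%n+[m/n]*n (suc n) 2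
... | zero | _ | n+1≡h*2 =
  subst (_≡2^ suc (ν₂-fuel f h) *odd) (sym n+1≡2h) (2*-≡2^*odd (≡2^ν₂-fuel*odd f h {{h≢0}} h≤f))
  where
  h : ℕ
  h = suc n / 2
  n+1≡2h : suc n ≡ 2 * h
  n+1≡2h = trans n+1≡h*2 (*-comm h 2)
  h≢0 : NonZero h
  h≢0 = m*n≢0⇒n≢0 2 {{subst NonZero n+1≡2h _}}
  h≤f : h ≤ f
  h≤f = ≤-pred (≤-trans (m/n<m (suc n) 2 (s≤s (s≤s z≤n))) (s≤s n≤f))
... | suc zero | _ | n+1≡1+h*2 =
  subst (_≡2^ 0 *odd) (sym (trans n+1≡1+h*2 (cong suc (*-comm (suc n / 2) 2)))) (odd-≡2^0*odd (suc n / 2))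
... | suc (suc _) | s≤s (s≤s ()) | _

≡2^*odd-unique : x ≡2^ a *odd → x ≡2^ b *odd → a ≡ b
≡2^*odd-unique {a = zero}  {b = zero}  _          _ = refl
≡2^*odd-unique {a = zero}  {b = suc b} (k , refl) (l , eq) =
  ⊥-elim (even≢odd (2 ^ b * suc (2 * l)) k
    (trans (sym (*-assoc 2 (2 ^ b) _)) (trans (sym eq) (*-identityˡ _))))
≡2^*odd-unique {a = suc a} {b = zero}  (k , refl) (l , eq) =
  ⊥-elim (even≢odd (2 ^ a * suc (2 * k)) l
    (trans (sym (*-assoc 2 (2 ^ a) _)) (trans eq (*-identityˡ _))))
≡2^*odd-unique {a = suc a} {b = suc b} (k , refl) (l , eq) =
  cong suc (≡2^*odd-unique (k , refl) (l , *-cancelˡ-≡ _ _ 2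
    (trans (sym (*-assoc 2 (2 ^ a) _)) (trans eq (*-assoc 2 (2 ^ b) _)))))

≡2^*odd⇒NonZero : x ≡2^ a *odd → NonZero x
≡2^*odd⇒NonZero {a = a} (k , refl) = m*n≢0 (2 ^ a) (suc (2 * k)) {{m^n≢0 2 a}}

≡2^ν₂*odd : ∀ x → .{{NonZero x}} → x ≡2^ ν₂ x *odd
≡2^ν₂*odd x = ≡2^ν₂-fuel*odd x x ≤-refl

ν₂-≡2^*odd : x ≡2^ a *odd → ν₂ x ≡ a
ν₂-≡2^*odd {x} p = ≡2^*odd-unique (≡2^ν₂*odd x {{≡2^*odd⇒NonZero p}}) p

*-≡2^*odd : x ≡2^ a *odd → y ≡2^ b *odd → x * y ≡2^ a + b *odd
*-≡2^*odd {a = a} {b = b} (k , refl) (l , refl) =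
  (k + l + 2 * k * l) , trans (odd*odd (2 ^ a) (2 ^ b) k l) (cong (_* _) (sym (^-distribˡ-+-* 2 a b)))
  where
  odd*odd : ∀ A B k l → A * suc (2 * k) * (B * suc (2 * l)) ≡ A * B * suc (2 * (k + l + 2 * k * l))
  odd*odd = solve-∀

+-≡2^*odd : x ≡2^ a *odd → 2 ^ suc a ∣ y → x + y ≡2^ a *odd
+-≡2^*odd {a = a} (k , refl) (divides r refl) = (k + r) , odd+even (2 ^ a) k r
  where
  odd+even : ∀ A k r → A * suc (2 * k) + r * (2 * A) ≡ A * suc (2 * (k + r))
  odd+even = solve-∀

≡2^*odd⇒2^∣ : x ≡2^ a *odd → b ≤ a → 2 ^ b ∣ x
≡2^*odd⇒2^∣ {a = a} {b = b} (k , refl) b≤a = ∣m⇒∣m*n (suc (2 * k)) 2^b∣2^a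
  where
  2^b∣2^a : 2 ^ b ∣ 2 ^ a
  2^b∣2^a = divides (2 ^ (a ∸ b)) (trans (cong (2 ^_) (sym (m∸n+n≡m b≤a))) (^-distribˡ-+-* 2 (a ∸ b) b))

ν₂-* : ∀ x y → .{{NonZero x}} → .{{NonZero y}} → ν₂ (x * y) ≡ ν₂ x + ν₂ y
ν₂-* x y = ν₂-≡2^*odd (*-≡2^*odd (≡2^ν₂*odd x) (≡2^ν₂*odd y))

ν₂-2^ : ∀ a → ν₂ (2 ^ a) ≡ a
ν₂-2^ a = ν₂-≡2^*odd (0 , sym (*-identityʳ (2 ^ a)))

ν₂-odd : ∀ k → ν₂ (suc (2 * k)) ≡ 0
ν₂-odd k = ν₂-≡2^*odd (odd-≡2^0*odd k)

ν₂>0⇒NonZero : ∀ x → 0 < ν₂ x → NonZero x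
ν₂>0⇒NonZero (suc _) _ = _

2^≤ν₂⇒2^∣ : ∀ x → a ≤ ν₂ x → 2 ^ a ∣ x
2^≤ν₂⇒2^∣ {a} zero    _      = (2 ^ a) ∣0
2^≤ν₂⇒2^∣     (suc n) a≤ν₂x = ≡2^*odd⇒2^∣ (≡2^ν₂*odd (suc n)) a≤ν₂x

ν₂-2* : ∀ x → .{{NonZero x}} → ν₂ (2 * x) ≡ suc (ν₂ x)
ν₂-2* x = ν₂-* 2 x

ν₂! : ℕ → ℕ
ν₂! n = ν₂ (n !)

ν₂!-suc : ∀ n → ν₂! (suc n) ≡ ν₂ (suc n) + ν₂! n
ν₂!-suc n = ν₂-* (suc n) (n !) {{_}} {{n !≢0}}

ν₂!-2* : ∀ n → ν₂! (2 * n) ≡ n + ν₂! n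
ν₂!-2* zero    = refl
ν₂!-2* (suc n) = begin
  ν₂! (2 * suc n)
    ≡⟨ cong ν₂! (*-suc 2 n) ⟩
  ν₂! (suc (suc (2 * n)))
    ≡⟨ trans (ν₂!-suc (suc (2 * n))) (cong₂ _+_ ν₂[2+2n]≡1+ν₂[1+n] (ν₂!-suc (2 * n))) ⟩
  suc (ν₂ (suc n)) + (ν₂ (suc (2 * n)) + ν₂! (2 * n))
    ≡⟨ cong₂ (λ u v → suc (ν₂ (suc n)) + (u + v)) (ν₂-odd n) (ν₂!-2* n) ⟩
  suc (ν₂ (suc n) + (n + ν₂! n))
    ≡⟨ cong suc (x∙yz≈y∙xz (ν₂ (suc n)) n (ν₂! n)) ⟩
  suc n + (ν₂ (suc n) + ν₂! n)
    ≡⟨ cong (_+_ (suc n)) (ν₂!-suc n) ⟨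
  suc n + ν₂! (suc n)
    ∎
  where
  open ≡-Reasoning
  ν₂[2+2n]≡1+ν₂[1+n] : ν₂ (suc (suc (2 * n))) ≡ suc (ν₂ (suc n))
  ν₂[2+2n]≡1+ν₂[1+n] = trans (cong ν₂ (sym (*-suc 2 n))) (ν₂-2* (suc n))

[m+n]Cm*[m!*n!]≡[m+n]! : ∀ m n → ((m + n) C m) * (m ! * n !) ≡ (m + n) !
[m+n]Cm*[m!*n!]≡[m+n]! m n = begin
  ((m + n) C m) * (m ! * n !)
    ≡⟨ cong (λ t → ((m + n) C m) * (m ! * t !)) (m+n∸m≡n m n) ⟨
  ((m + n) C m) * (m ! * (m + n ∸ m) !)
    ≡⟨ cong (_* (m ! * (m + n ∸ m) !)) (nCk≡n!/k![n-k]! (m≤m+n m n)) ⟩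
  ((m + n) ! / (m ! * (m + n ∸ m) !)) * (m ! * (m + n ∸ m) !)
    ≡⟨ m/n*n≡m (k![n∸k]!∣n! (m≤m+n m n)) ⟩
  (m + n) !
    ∎
  where
  open ≡-Reasoning
  instance
    m!*[m+n∸m]!≢0 : NonZero (m ! * (m + n ∸ m) !)
    m!*[m+n∸m]!≢0 = m !* (m + n ∸ m) !≢0

ν₂!-+ : ∀ m n → ν₂! m + ν₂! n ≤ ν₂! (m + n)
ν₂!-+ m n = begin
  ν₂! m + ν₂! n
    ≤⟨ m≤n+m (ν₂! m + ν₂! n) (ν₂ binomial) ⟩
  ν₂ binomial + (ν₂! m + ν₂! n)
    ≡⟨ cong (_+_ (ν₂ binomial)) (ν₂-* (m !) (n !) {{m !≢0}} {{n !≢0}}) ⟨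
  ν₂ binomial + ν₂ (m ! * n !)
    ≡⟨ ν₂-* binomial (m ! * n !) {{binomial≢0}} {{m !* n !≢0}} ⟨
  ν₂ (binomial * (m ! * n !))
    ≡⟨ cong ν₂ ([m+n]Cm*[m!*n!]≡[m+n]! m n) ⟩
  ν₂! (m + n)
    ∎
  where
  open ≤-Reasoning
  binomial : ℕ
  binomial = (m + n) C m
  binomial≢0 : NonZero binomial
  binomial≢0 = m*n≢0⇒m≢0 binomial {{subst NonZero (sym ([m+n]Cm*[m!*n!]≡[m+n]! m n)) ((m + n) !≢0)}}

1≤ν₂![2+n] : ∀ n → 1 ≤ ν₂! (2 + n)
1≤ν₂![2+n] n = ≤-trans (m≤m+n 1 (ν₂! n)) (ν₂!-+ 2 n)

*-distribˡ-sum : ∀ c xs → c * sum xs ≡ sum (map (c *_) xs)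
*-distribˡ-sum c []       = *-zeroʳ c
*-distribˡ-sum c (x ∷ xs) = trans (*-distribˡ-+ c x (sum xs)) (cong (_+_ (c * x)) (*-distribˡ-sum c xs))

∣-sum : ∀ {d xs} → All (d ∣_) xs → d ∣ sum xs
∣-sum {d} []       = d ∣0
∣-sum     (p ∷ ps) = ∣m∣n⇒∣m+n p (∣-sum ps)

-- For k = 1 + j this is definitionally the j-th term of the list summed in S 1 m.
summand : ℕ → ℕ → ℕ
summand m k = 2 ^ k * (((2 * m ∸ 2 * k) C (m ∸ k)) * (((m + k) C m) * (k C 1)))

m!*summand*j!j!k!≡2^k*k*[2j]!*[m+k]! : ∀ m k → let j = m ∸ k in
  m ! * summand m k * (j ! * (j ! * k !)) ≡ 2 ^ k * k * ((2 * j) ! * (m + k) !)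
m!*summand*j!j!k!≡2^k*k*[2j]!*[m+k]! m k = begin
  m ! * summand m k * (j ! * (j ! * k !))
    ≡⟨ cong (λ t → m ! * t * (j ! * (j ! * k !))) summand≡ ⟩
  m ! * (2 ^ k * (central * (((m + k) C m) * k))) * (j ! * (j ! * k !))
    ≡⟨ regroup (m !) (2 ^ k) central ((m + k) C m) k (j !) (k !) ⟩
  2 ^ k * k * ((central * (j ! * j !)) * (((m + k) C m) * (m ! * k !)))
    ≡⟨ cong₂ (λ u v → 2 ^ k * k * (u * v)) central*j!j!≡[2j]! ([m+n]Cm*[m!*n!]≡[m+n]! m k) ⟩
  2 ^ k * k * ((2 * j) ! * (m + k) !)
    ∎
  where
  open ≡-Reasoning
  j central : ℕ
  j = m ∸ k
  central = (2 * j) C j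
  summand≡ : summand m k ≡ 2 ^ k * (central * (((m + k) C m) * k))
  summand≡ = cong₂ (λ n l → 2 ^ k * ((n C j) * (((m + k) C m) * l))) (sym (*-distribˡ-∸ 2 m k)) (nC1≡n k)
  2j≡j+j : 2 * j ≡ j + j
  2j≡j+j = cong (_+_ j) (+-identityʳ j)
  central*j!j!≡[2j]! : central * (j ! * j !) ≡ (2 * j) !
  central*j!j!≡[2j]! = subst (λ n → (n C j) * (j ! * j !) ≡ n !) (sym 2j≡j+j) ([m+n]Cm*[m!*n!]≡[m+n]! j j)
  regroup : ∀ M P A B K J Kf →
            M * (P * (A * (B * K))) * (J * (J * Kf)) ≡ P * K * ((A * (J * J)) * (B * (M * Kf)))
  regroup = solve-∀

ν₂-summand : ∀ {m k} → k ≤ m → .{{NonZero k}} →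
  ν₂ (m ! * summand m k) + ν₂! (m ∸ k) + ν₂! k ≡ m + ν₂ k + ν₂! (m + k)
ν₂-summand {m} {k} k≤m = +-cancelʳ-≡ (ν₂! j) _ _ (begin
  ν₂ X + ν₂! j + ν₂! k + ν₂! j
    ≡⟨ regroupˡ (ν₂ X) (ν₂! j) (ν₂! k) ⟩
  ν₂ X + (ν₂! j + (ν₂! j + ν₂! k))
    ≡⟨ cong (_+_ (ν₂ X)) ν₂-denominator ⟨
  ν₂ X + ν₂ D
    ≡⟨ ν₂-* X D {{X≢0}} {{D≢0}} ⟨
  ν₂ (X * D)
    ≡⟨ cong ν₂ X*D≡P ⟩
  ν₂ P
    ≡⟨ ν₂-numerator ⟩
  k + ν₂ k + (j + ν₂! j + ν₂! (m + k))
    ≡⟨ regroupʳ k (ν₂ k) j (ν₂! j) (ν₂! (m + k)) ⟩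
  j + k + ν₂ k + ν₂! (m + k) + ν₂! j
    ≡⟨ cong (λ n → n + ν₂ k + ν₂! (m + k) + ν₂! j) (m∸n+n≡m k≤m) ⟩
  m + ν₂ k + ν₂! (m + k) + ν₂! j
    ∎)
  where
  open ≡-Reasoning
  j X D P : ℕ
  j = m ∸ k
  X = m ! * summand m k
  D = j ! * (j ! * k !)
  P = 2 ^ k * k * ((2 * j) ! * (m + k) !)
  X*D≡P : X * D ≡ P
  X*D≡P = m!*summand*j!j!k!≡2^k*k*[2j]!*[m+k]! m k
  instance
    2^k≢0 : NonZero (2 ^ k)
    2^k≢0 = m^n≢0 2 k
  D≢0 : NonZero D
  D≢0 = m*n≢0 (j !) (j ! * k !) {{j !≢0}} {{j !* k !≢0}}
  P≢0 : NonZero P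
  P≢0 = m*n≢0 (2 ^ k * k) ((2 * j) ! * (m + k) !) {{m*n≢0 (2 ^ k) k}} {{(2 * j) !* (m + k) !≢0}}
  X≢0 : NonZero X
  X≢0 = m*n≢0⇒m≢0 X {{subst NonZero (sym X*D≡P) P≢0}}
  ν₂-denominator : ν₂ D ≡ ν₂! j + (ν₂! j + ν₂! k)
  ν₂-denominator = trans (ν₂-* (j !) (j ! * k !) {{j !≢0}} {{j !* k !≢0}})
                         (cong (_+_ (ν₂! j)) (ν₂-* (j !) (k !) {{j !≢0}} {{k !≢0}}))
  ν₂-numerator : ν₂ P ≡ k + ν₂ k + (j + ν₂! j + ν₂! (m + k))
  ν₂-numerator = begin
    ν₂ P
      ≡⟨ ν₂-* (2 ^ k * k) ((2 * j) ! * (m + k) !) {{m*n≢0 (2 ^ k) k}} {{(2 * j) !* (m + k) !≢0}} ⟩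
    ν₂ (2 ^ k * k) + ν₂ ((2 * j) ! * (m + k) !)
      ≡⟨ cong₂ _+_ (ν₂-* (2 ^ k) k) (ν₂-* ((2 * j) !) ((m + k) !) {{(2 * j) !≢0}} {{(m + k) !≢0}}) ⟩
    ν₂ (2 ^ k) + ν₂ k + (ν₂! (2 * j) + ν₂! (m + k))
      ≡⟨ cong₂ (λ u v → u + ν₂ k + (v + ν₂! (m + k))) (ν₂-2^ k) (ν₂!-2* j) ⟩
    k + ν₂ k + (j + ν₂! j + ν₂! (m + k))
      ∎
  regroupˡ : ∀ t a b → t + a + b + a ≡ t + (a + (a + b))
  regroupˡ = solve-∀
  regroupʳ : ∀ k v j a c → k + v + (j + a + c) ≡ j + k + v + c + a
  regroupʳ = solve-∀

ν₂-summand-≥ : ∀ {m k} → k ≤ m → .{{NonZero k}} → m + ν₂ (suc m) + ν₂! k ≤ ν₂ (m ! * summand m k)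
ν₂-summand-≥ {m} {k@(suc k′)} k≤m = +-cancelʳ-≤ (ν₂! j + ν₂! k) _ _ (begin
  m + ν₂ (suc m) + ν₂! k + (ν₂! j + ν₂! k)
    ≡⟨ regroupˡ m (ν₂ (suc m)) (ν₂! k) (ν₂! j + ν₂! k) ⟩
  m + ν₂ (suc m) + (ν₂! j + ν₂! k) + ν₂! k
    ≤⟨ +-mono-≤ (+-monoʳ-≤ (m + ν₂ (suc m)) ν₂!j+ν₂!k≤ν₂!m) (≤-reflexive (ν₂!-suc k′)) ⟩
  m + ν₂ (suc m) + ν₂! m + (ν₂ k + ν₂! k′)
    ≡⟨ regroupʳ m (ν₂ (suc m)) (ν₂! m) (ν₂ k) (ν₂! k′) ⟩
  m + ν₂ k + (ν₂ (suc m) + ν₂! m + ν₂! k′)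
    ≡⟨ cong (λ t → m + ν₂ k + (t + ν₂! k′)) (ν₂!-suc m) ⟨
  m + ν₂ k + (ν₂! (suc m) + ν₂! k′)
    ≤⟨ +-monoʳ-≤ (m + ν₂ k) (ν₂!-+ (suc m) k′) ⟩
  m + ν₂ k + ν₂! (suc m + k′)
    ≡⟨ cong (λ t → m + ν₂ k + ν₂! t) (+-suc m k′) ⟨
  m + ν₂ k + ν₂! (m + k)
    ≡⟨ ν₂-summand k≤m ⟨
  ν₂ X + ν₂! j + ν₂! k
    ≡⟨ +-assoc (ν₂ X) (ν₂! j) (ν₂! k) ⟩
  ν₂ X + (ν₂! j + ν₂! k)
    ∎)
  where
  open ≤-Reasoning
  j X : ℕ
  j = m ∸ k
  X = m ! * summand m k
  ν₂!j+ν₂!k≤ν₂!m : ν₂! j + ν₂! k ≤ ν₂! m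
  ν₂!j+ν₂!k≤ν₂!m = subst (λ n → ν₂! j + ν₂! k ≤ ν₂! n) (m∸n+n≡m k≤m) (ν₂!-+ j k)
  regroupˡ : ∀ a b c d → a + b + c + d ≡ a + b + d + c
  regroupˡ = solve-∀
  regroupʳ : ∀ a b c d e → a + b + c + (d + e) ≡ a + d + (b + c + e)
  regroupʳ = solve-∀

ν₂-first-summand : ∀ n → ν₂ (suc n ! * summand (suc n) 1) ≡ suc n + ν₂ (suc (suc n)) + ν₂ (suc n)
ν₂-first-summand n = +-cancelʳ-≡ (ν₂! n) _ _ (begin
  ν₂ X + ν₂! n
    ≡⟨ +-identityʳ (ν₂ X + ν₂! n) ⟨
  ν₂ X + ν₂! n + ν₂! 1
    ≡⟨ ν₂-summand {suc n} {1} (s≤s z≤n) ⟩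
  suc n + ν₂ 1 + ν₂! (suc n + 1)
    ≡⟨ cong (λ t → suc n + 0 + ν₂! t) (+-comm (suc n) 1) ⟩
  suc n + 0 + ν₂! (suc (suc n))
    ≡⟨ cong (_+_ (suc n + 0)) (trans (ν₂!-suc (suc n)) (cong (_+_ (ν₂ (suc (suc n)))) (ν₂!-suc n))) ⟩
  suc n + 0 + (ν₂ (suc (suc n)) + (ν₂ (suc n) + ν₂! n))
    ≡⟨ regroup (suc n) (ν₂ (suc (suc n))) (ν₂ (suc n)) (ν₂! n) ⟩
  suc n + ν₂ (suc (suc n)) + ν₂ (suc n) + ν₂! n
    ∎)
  where
  open ≡-Reasoning
  X : ℕ
  X = suc n ! * summand (suc n) 1
  regroup : ∀ a b c d → a + 0 + (b + (c + d)) ≡ a + b + c + d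
  regroup = solve-∀

m!*S₁m≡2^[m+ν₂[1+m]]*odd : ∀ n → let m = suc (2 * n) in m ! * S 1 m ≡2^ m + ν₂ (suc m) *odd
m!*S₁m≡2^[m+ν₂[1+m]]*odd n =
  subst (_≡2^ e *odd) (sym m!*S₁m-split)
    (+-≡2^*odd leading (∣-sum (map⁺ (map⁺ (applyUpTo⁺₁ suc (2 * n) higher)))))
  where
  m e : ℕ
  m = suc (2 * n)
  e = m + ν₂ (suc m)
  higher-summands : List ℕ
  higher-summands = map (summand m ∘ suc) (applyUpTo suc (2 * n))
  m!*S₁m-split : m ! * S 1 m ≡ m ! * summand m 1 + sum (map (m ! *_) higher-summands)
  m!*S₁m-split = trans (*-distribˡ-+ (m !) (summand m 1) (sum higher-summands))
                       (cong (_+_ (m ! * summand m 1)) (*-distribˡ-sum (m !) higher-summands))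
  ν₂-leading : ν₂ (m ! * summand m 1) ≡ e
  ν₂-leading = trans (ν₂-first-summand (2 * n)) (trans (cong (_+_ e) (ν₂-odd n)) (+-identityʳ e))
  leading : m ! * summand m 1 ≡2^ e *odd
  leading = subst (m ! * summand m 1 ≡2^_*odd) ν₂-leading
    (≡2^ν₂*odd _ {{ν₂>0⇒NonZero _ (subst (0 <_) (sym ν₂-leading) (s≤s z≤n))}})
  higher : ∀ {i} → i < 2 * n → 2 ^ suc e ∣ m ! * summand m (2 + i)
  higher {i} i<2n = 2^≤ν₂⇒2^∣ _ (begin
    suc e                     ≡⟨ +-comm 1 e ⟩
    e + 1                     ≤⟨ +-monoʳ-≤ e (1≤ν₂![2+n] i) ⟩
    e + ν₂! (2 + i)           ≤⟨ ν₂-summand-≥ (s≤s i<2n) ⟩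
    ν₂ (m ! * summand m (2 + i)) ∎)
    where open ≤-Reasoning

+[m+n]-+m≡+n : ∀ m n → + (m + n) - + m ≡ + n
+[m+n]-+m≡+n m n =
  trans (ℤ.[+m]-[+n]≡m⊖n (m + n) m) (trans (ℤ.⊖-≥ (m≤m+n m n)) (cong +_ (m+n∸m≡n m n)))

T[X1]⊖c≡2 : ∀ i → (T X1 ⊖ c) i ≡ + 2
T[X1]⊖c≡2 i = begin
  + ν₂ (1 ! * (m ! * S 1 m)) - + (2 * i) - + v  ≡⟨ cong (λ t → + t - + (2 * i) - + v) ν₂[m!S₁m] ⟩
  + (2 * i + (2 + v)) - + (2 * i) - + v        ≡⟨ cong (_- + v) (+[m+n]-+m≡+n (2 * i) (2 + v)) ⟩
  + (2 + v) - + v                              ≡⟨ cong (λ t → + t - + v) (+-comm 2 v) ⟩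
  + (v + 2) - + v                              ≡⟨ +[m+n]-+m≡+n v 2 ⟩
  + 2                                          ∎
  where
  open ≡-Reasoning
  m v : ℕ
  m = suc (2 * i)
  v = ν₂ (suc i)
  ν₂[m!S₁m] : ν₂ (1 ! * (m ! * S 1 m)) ≡ 2 * i + (2 + v)
  ν₂[m!S₁m] = begin
    ν₂ (1 ! * (m ! * S 1 m))  ≡⟨ cong ν₂ (*-identityˡ (m ! * S 1 m)) ⟩
    ν₂ (m ! * S 1 m)          ≡⟨ ν₂-≡2^*odd (m!*S₁m≡2^[m+ν₂[1+m]]*odd i) ⟩
    m + ν₂ (suc m)            ≡⟨ cong (λ t → m + ν₂ t) (*-suc 2 i) ⟨
    m + ν₂ (2 * suc i)        ≡⟨ cong (_+_ m) (ν₂-2* (suc i)) ⟩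
    m + suc v                 ≡⟨ +-suc (2 * i) (suc v) ⟨
    2 * i + (2 + v)           ∎

lemma5p2 : ∀ (i : ℕ) → F (T X1 ⊖ c) i ≡ + 2
lemma5p2 zero    = T[X1]⊖c≡2 0
lemma5p2 (suc i) = T[X1]⊖c≡2 i
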